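{- Let $\mathbf T=\langle V,\mathbf{root},E,R_1,\dots,R_k\rangle\in\mathcal T$ with $h$ levels, let $s,t\ge1$ with $s+t\le m$, and let $R\subseteq V^{t+s}$ be an invariant relation on $\langle V,E\rangle$. Let $\phi_R(z_1,\dots,z_s)=\forall y_1\cdots\forall y_t\,R y_1\cdots y_t z_1\cdots z_s$ and $Q_1=\{\bar a\in V^s:\mathbf T\models\phi_R[\bar a]\}$. Let $Q_2$ be the set of tuples $\bar e\in\{0,\dots,h-1\}^{s(s+1)/2}$ such that (i) $\bar e\in (V^s)^*$ (i.e. $\bar e$ is the characteristic tuple of some $s$-tuple of nodes; equivalently $S_{\mathbf T}\models FUL_m^*(z_1\cdots z_s z_s\cdots z_s)^*[\bar e]$), and (ii) for every tuple $\bar g\in\{0,\dots,h-1\}^{(t+s)(t+s+1)/2}$ whose entries at the positions indexed by $i_{z_j}$ and $i_{z_j\barwedge z_l}$ coincide with the corresponding entries of $\bar e$ and which is the characteristic tuple of some $(t+s)$-tuple of nodes, we have $\bar g\in R^*$. (That is, $Q_2$ is the set of tuples satisfying in $S_{\mathbf T}$ the formula $\Phi_R = FUL_m^*(z_1\cdots z_sz_s\cdots z_s)^*\wedge\forall(\text{all variables }i_{y_j},i_{y_j\barwedge y_l},i_{y_j\barwedge z_l})(FUL_m^*(y_1\cdots y_tz_1\cdots z_sz_s\cdots z_s)^*\rightarrow R^*(y_1\cdots y_tz_1\cdots z_s)^*)$.) Then $(Q_1)^*=Q_2$.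
   Context: Fix $\tau=\{R_1,\dots,R_k\}$ and a natural number $m$. $\mathcal T$ is the class of finite structures $\langle V,\mathbf{root},E,R_1,\dots,R_k\rangle$ where $\langle V,E\rangle$ is a perfect binary tree (a full binary tree with all leaves at the same level, edges directed from parent to child), $\mathbf{root}$ is its root, and each $R_i$ is saturated: whenever $d(a_j)=d(b_j)$ for all $j$, $(a_1,\dots)\in R_i\iff(b_1,\dots)\in R_i$. Here $d(a)$ is the depth of $a$ (root has depth 0), and the tree has $h$ levels $0,\dots,h-1$. $a\barwedge b$ denotes the least common ancestor. A relation $R\subseteq V^r$ is invariant if $f[R]=R$ for every automorphism $f$ of $\langle V,E\rangle$. The characteristic tuple of $(a_1,\dots,a_r)$ is $(d(a_1),d(a_1\barwedge a_2),\dots,d(a_1\barwedge a_r),d(a_2),d(a_2\barwedge a_3),\dots,d(a_2\barwedge a_r),\dots,d(a_r))$ (length $r(r+1)/2$); for a relation $R$, $R^*$ is the set of characteristic tuples of its elements; for a list of variables $x_1\cdots x_r$, $(x_1\cdots x_r)^*$ denotes the variable list $i_{x_1}i_{x_1\barwedge x_2}\cdots i_{x_1\barwedge x_r}i_{x_2}\cdots i_{x_r}$ in this order (with $i_{u\barwedge v}=i_{v\barwedge u}$ and $i_{u\barwedge u}=i_u$). $FUL_m=V^m$ and $FUL_m^*$ is its characteristic relation. $S_{\mathbf T}$ is the structure with domain $\{0,\dots,h-1\}$ interpreting $FUL_m^*$ and $R^*$ as these characteristic relations. -}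

module Defs where

open import Data.Nat using (ℕ; zero; suc; _+_; _*_; _<_; _≤_; _/_)
open import Data.Bool using (Bool; true; false)
open import Data.List as L using (List; []; _∷_; length; _∷ʳ_; zip)
open import Data.List.Relation.Unary.All using (All)
open import Data.List.Membership.Propositional using (_∈_)
open import Data.Vec as V using (Vec; toList; allFin)
open import Data.Fin using (Fin; _↑ʳ_)
open import Data.Product using (Σ; ∃; _×_; _,_)
open import Relation.Binary.PropositionalEquality using (_≡_)

-- Nodes of the perfect binary tree with h levels (depths 0 … h-1):
-- a node is its path from the root (list of left/right choices),
-- of length < h.  The root is the empty path.
record Node (h : ℕ) : Set where
  constructor node
  field
    path   : List Bool
    .bound : length path < h
open Node public

root : ∀ {h} → 0 < h → Node h
root p = node [] p

depth : ∀ {h} → Node h → ℕ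
depth a = length (path a)

E : ∀ {h} → Node h → Node h → Set
E a b = Σ Bool λ x → path b ≡ path a ∷ʳ x

-- path of the least common ancestor = longest common prefix of the paths
commonPrefix : List Bool → List Bool → List Bool
commonPrefix (true ∷ xs)  (true ∷ ys)  = true ∷ commonPrefix xs ys
commonPrefix (false ∷ xs) (false ∷ ys) = false ∷ commonPrefix xs ys
commonPrefix _ _ = []

lcaDepth : ∀ {h} → Node h → Node h → ℕ
lcaDepth a b = length (commonPrefix (path a) (path b))

charTuple : ∀ {h r} → Vec (Node h) r → List ℕ
charTuple V.[] = []
charTuple (a V.∷ as) = depth a ∷ (L.map (lcaDepth a) (toList as) L.++ charTuple as)

-- The variable list (x₁⋯x_r)^* : the variable i_{xⱼ⊼xₗ} (j ≤ l) is
-- represented by the pair (xⱼ , xₗ); i_{x⊼x} = i_x is (x , x).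
charVars : ∀ {A : Set} → List A → List (A × A)
charVars [] = []
charVars (x ∷ xs) = (x , x) ∷ (L.map (x ,_) xs L.++ charVars xs)

tri : ℕ → ℕ
tri r = (r * suc r) / 2

InRange : ℕ → ℕ → List ℕ → Set
InRange h n e = length e ≡ n × All (_< h) e

record Aut (h : ℕ) : Set where
  field
    fun   : Node h → Node h
    inv   : Node h → Node h
    left  : ∀ x → inv (fun x) ≡ x
    right : ∀ x → fun (inv x) ≡ x
    pres  : ∀ a b → (E a b → E (fun a) (fun b)) × (E (fun a) (fun b) → E a b)
open Aut public

Image : ∀ {h r} → Aut h → (Vec (Node h) r → Set) → Vec (Node h) r → Set
Image α R b = ∃ λ a → R a × b ≡ V.map (fun α) a

Invariant : ∀ {h r} → (Vec (Node h) r → Set) → Set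
Invariant {h} R = (α : Aut h) →
  (∀ b → Image α R b → R b) × (∀ b → R b → Image α R b)

CharRel : ∀ {h r} → (Vec (Node h) r → Set) → List ℕ → Set
CharRel {h} {r} R g = ∃ λ (b : Vec (Node h) r) → R b × charTuple b ≡ g

IsChar : ℕ → ℕ → List ℕ → Set
IsChar h r g = ∃ λ (b : Vec (Node h) r) → charTuple b ≡ g

Q₁ : ∀ {h} s t → (Vec (Node h) (t + s) → Set) → Vec (Node h) s → Set
Q₁ {h} s t R a = (y : Vec (Node h) t) → R (y V.++ a)

Q₁* : ∀ {h} s t → (Vec (Node h) (t + s) → Set) → List ℕ → Set
Q₁* {h} s t R e = ∃ λ (a : Vec (Node h) s) → Q₁ s t R a × charTuple a ≡ e

-- variables of the full tuple y₁⋯y_t z₁⋯z_s (indices Fin (t+s), zⱼ = t+j)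
varsYZ : ∀ s t → List (Fin (t + s) × Fin (t + s))
varsYZ s t = charVars (toList (allFin (t + s)))

varsZ : ∀ s t → List (Fin (t + s) × Fin (t + s))
varsZ s t = charVars (toList (V.map (t ↑ʳ_) (allFin s)))

Agree : ∀ s t → List ℕ → List ℕ → Set
Agree s t g e = ∀ {v x y} → (v , x) ∈ zip (varsYZ s t) g → (v , y) ∈ zip (varsZ s t) e → x ≡ y

Q₂ : ∀ h s t → (Vec (Node h) (t + s) → Set) → List ℕ → Set
Q₂ h s t R e =
  InRange h (tri s) e × IsChar h s e ×
  (∀ g → InRange h (tri (t + s)) g → Agree s t g e → IsChar h (t + s) g → CharRel R g)

module Submission where

-- The automorphism group of a perfect binary tree acts transitively on the
-- tuples with a given characteristic tuple: if b and c have the same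
-- characteristic tuple, an automorphism maps b to c.  It is built one
-- coordinate at a time, by flipping subtrees along the path of the image of
-- the new coordinate, which leaves fixed every coordinate already placed.
-- Hence an invariant relation is a union of characteristic classes, and
-- "R ȳ ā for all ȳ" depends only on the characteristic tuple of ā; both
-- inclusions then follow by moving tuples around with such automorphisms.

open import Defs
open import Data.Nat using (ℕ; zero; suc; _+_; _*_; _/_; _<_; _≤_; z≤n; s≤s; _<?_)
open import Data.Nat.Properties using (suc-injective; ≤-trans; +-comm)
open import Data.Nat.DivMod using (+-distrib-/-∣ʳ; m*n/n≡m)
open import Data.Nat.Divisibility using (divides)
open import Data.Nat.Tactic.RingSolver using (solve-∀)
open import Data.Bool using (Bool; true; false; not)
open import Data.List as L using (List; []; _∷_; length; _∷ʳ_; zip)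
import Data.List.Properties as Listₚ
open import Data.List.Membership.Propositional using (_∈_)
open import Data.List.Membership.Propositional.Properties using (∈-map⁺; ∈-map⁻; ∈-++⁺ʳ)
open import Data.List.Relation.Unary.All as All using (All; []; _∷_)
import Data.List.Relation.Unary.All.Properties as Allₚ
open import Data.List.Relation.Unary.Any using (there)
open import Data.Vec as V using (Vec; toList; allFin; lookup)
import Data.Vec.Properties as Vecₚ
open import Data.Fin as Fin using (Fin; _↑ˡ_; _↑ʳ_)
open import Data.Product using (Σ; ∃; _×_; _,_; proj₁; proj₂; map₂)
open import Function using (_∘_; id)
open import Relation.Binary.PropositionalEquality
open ≡-Reasoning
open import Relation.Nullary.Decidable using (recompute)

private
  variable
    A B : Set
    h n s t : ℕ

lcp : List Bool → List Bool → ℕ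
lcp x y = length (commonPrefix x y)

lcp-self : ∀ x → lcp x x ≡ length x
lcp-self []          = refl
lcp-self (false ∷ x) = cong suc (lcp-self x)
lcp-self (true ∷ x)  = cong suc (lcp-self x)

lcp-≤ : ∀ x y → lcp x y ≤ length x
lcp-≤ []          y           = z≤n
lcp-≤ (false ∷ x) []          = z≤n
lcp-≤ (true ∷ x)  []          = z≤n
lcp-≤ (false ∷ x) (false ∷ y) = s≤s (lcp-≤ x y)
lcp-≤ (true ∷ x)  (true ∷ y)  = s≤s (lcp-≤ x y)
lcp-≤ (false ∷ x) (true ∷ y)  = z≤n
lcp-≤ (true ∷ x)  (false ∷ y) = z≤n

commonPrefix-[] : ∀ x → commonPrefix x [] ≡ []
commonPrefix-[] []          = refl
commonPrefix-[] (false ∷ x) = refl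
commonPrefix-[] (true ∷ x)  = refl

-- The two subtrees below the i-th vertex of the path x are exchanged exactly
-- when x and y differ at position i; nodes leaving x are moved rigidly.
redirect : List Bool → List Bool → List Bool → List Bool
redirect []      y       z           = z
redirect (a ∷ x) []      z           = z
redirect (a ∷ x) (b ∷ y) []          = []
redirect (false ∷ x) (b ∷ y) (false ∷ z) = b ∷ redirect x y z
redirect (true ∷ x)  (b ∷ y) (true ∷ z)  = b ∷ redirect x y z
redirect (false ∷ x) (b ∷ y) (true ∷ z)  = not b ∷ z
redirect (true ∷ x)  (b ∷ y) (false ∷ z) = not b ∷ z

redirect-[] : ∀ x y → redirect x y [] ≡ []
redirect-[] []      y       = refl
redirect-[] (a ∷ x) []      = refl
redirect-[] (a ∷ x) (b ∷ y) = refl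

length-redirect : ∀ x y z → length (redirect x y z) ≡ length z
length-redirect []      y       z  = refl
length-redirect (a ∷ x) []      z  = refl
length-redirect (a ∷ x) (b ∷ y) [] = refl
length-redirect (false ∷ x) (b ∷ y) (false ∷ z) = cong suc (length-redirect x y z)
length-redirect (true ∷ x)  (b ∷ y) (true ∷ z)  = cong suc (length-redirect x y z)
length-redirect (false ∷ x) (b ∷ y) (true ∷ z)  = refl
length-redirect (true ∷ x)  (b ∷ y) (false ∷ z) = refl

redirect-inverse : ∀ x y z → redirect y x (redirect x y z) ≡ z
redirect-inverse []      []      z  = refl
redirect-inverse []      (b ∷ y) z  = refl
redirect-inverse (a ∷ x) []      z  = refl
redirect-inverse (a ∷ x) (b ∷ y) [] = refl
redirect-inverse (false ∷ x) (false ∷ y) (false ∷ z) = cong (false ∷_) (redirect-inverse x y z)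
redirect-inverse (false ∷ x) (true ∷ y)  (false ∷ z) = cong (false ∷_) (redirect-inverse x y z)
redirect-inverse (true ∷ x)  (false ∷ y) (true ∷ z)  = cong (true ∷_) (redirect-inverse x y z)
redirect-inverse (true ∷ x)  (true ∷ y)  (true ∷ z)  = cong (true ∷_) (redirect-inverse x y z)
redirect-inverse (false ∷ x) (false ∷ y) (true ∷ z)  = refl
redirect-inverse (false ∷ x) (true ∷ y)  (true ∷ z)  = refl
redirect-inverse (true ∷ x)  (false ∷ y) (false ∷ z) = refl
redirect-inverse (true ∷ x)  (true ∷ y)  (false ∷ z) = refl

redirect-source : ∀ x y → length x ≡ length y → redirect x y x ≡ y
redirect-source []          []      _  = refl
redirect-source (false ∷ x) (b ∷ y) eq = cong (b ∷_) (redirect-source x y (suc-injective eq))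
redirect-source (true ∷ x)  (b ∷ y) eq = cong (b ∷_) (redirect-source x y (suc-injective eq))

redirect-fixes : ∀ x y w → lcp x w ≡ lcp y w → redirect x y w ≡ w
redirect-fixes []      y       w  _ = refl
redirect-fixes (a ∷ x) []      w  _ = refl
redirect-fixes (a ∷ x) (b ∷ y) [] _ = refl
redirect-fixes (false ∷ x) (false ∷ y) (false ∷ w) eq = cong (false ∷_) (redirect-fixes x y w (suc-injective eq))
redirect-fixes (true ∷ x)  (true ∷ y)  (true ∷ w)  eq = cong (true ∷_) (redirect-fixes x y w (suc-injective eq))
redirect-fixes (false ∷ x) (false ∷ y) (true ∷ w)  _  = refl
redirect-fixes (true ∷ x)  (true ∷ y)  (false ∷ w) _  = refl
redirect-fixes (false ∷ x) (true ∷ y)  (false ∷ w) ()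
redirect-fixes (true ∷ x)  (false ∷ y) (true ∷ w)  ()
redirect-fixes (false ∷ x) (true ∷ y)  (true ∷ w)  ()
redirect-fixes (true ∷ x)  (false ∷ y) (false ∷ w) ()

lcp-redirect : ∀ x y u w → lcp (redirect x y u) (redirect x y w) ≡ lcp u w
lcp-redirect []      y       u       w  = refl
lcp-redirect (a ∷ x) []      u       w  = refl
lcp-redirect (a ∷ x) (b ∷ y) []      w  rewrite redirect-[] (a ∷ x) (b ∷ y) = refl
lcp-redirect (a ∷ x) (b ∷ y) (c ∷ u) [] =
  cong length (trans (commonPrefix-[] (redirect (a ∷ x) (b ∷ y) (c ∷ u))) (sym (commonPrefix-[] (c ∷ u))))
lcp-redirect (false ∷ x) (false ∷ y) (false ∷ u) (false ∷ w) = cong suc (lcp-redirect x y u w)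
lcp-redirect (false ∷ x) (false ∷ y) (false ∷ u) (true ∷ w)  = refl
lcp-redirect (false ∷ x) (false ∷ y) (true ∷ u)  (false ∷ w) = refl
lcp-redirect (false ∷ x) (false ∷ y) (true ∷ u)  (true ∷ w)  = refl
lcp-redirect (false ∷ x) (true ∷ y)  (false ∷ u) (false ∷ w) = cong suc (lcp-redirect x y u w)
lcp-redirect (false ∷ x) (true ∷ y)  (false ∷ u) (true ∷ w)  = refl
lcp-redirect (false ∷ x) (true ∷ y)  (true ∷ u)  (false ∷ w) = refl
lcp-redirect (false ∷ x) (true ∷ y)  (true ∷ u)  (true ∷ w)  = refl
lcp-redirect (true ∷ x)  (false ∷ y) (false ∷ u) (false ∷ w) = refl
lcp-redirect (true ∷ x)  (false ∷ y) (false ∷ u) (true ∷ w)  = refl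
lcp-redirect (true ∷ x)  (false ∷ y) (true ∷ u)  (false ∷ w) = refl
lcp-redirect (true ∷ x)  (false ∷ y) (true ∷ u)  (true ∷ w)  = cong suc (lcp-redirect x y u w)
lcp-redirect (true ∷ x)  (true ∷ y)  (false ∷ u) (false ∷ w) = refl
lcp-redirect (true ∷ x)  (true ∷ y)  (false ∷ u) (true ∷ w)  = refl
lcp-redirect (true ∷ x)  (true ∷ y)  (true ∷ u)  (false ∷ w) = refl
lcp-redirect (true ∷ x)  (true ∷ y)  (true ∷ u)  (true ∷ w)  = cong suc (lcp-redirect x y u w)

redirect-∷ʳ : ∀ x y z c → ∃ λ c′ → redirect x y (z ∷ʳ c) ≡ redirect x y z ∷ʳ c′
redirect-∷ʳ []      y       z  c = c , refl
redirect-∷ʳ (a ∷ x) []      z  c = c , refl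
redirect-∷ʳ (false ∷ x) (b ∷ y) [] false = b , cong (b ∷_) (redirect-[] x y)
redirect-∷ʳ (true ∷ x)  (b ∷ y) [] true  = b , cong (b ∷_) (redirect-[] x y)
redirect-∷ʳ (false ∷ x) (b ∷ y) [] true  = not b , refl
redirect-∷ʳ (true ∷ x)  (b ∷ y) [] false = not b , refl
redirect-∷ʳ (false ∷ x) (b ∷ y) (false ∷ z) c = map₂ (cong (b ∷_)) (redirect-∷ʳ x y z c)
redirect-∷ʳ (true ∷ x)  (b ∷ y) (true ∷ z)  c = map₂ (cong (b ∷_)) (redirect-∷ʳ x y z c)
redirect-∷ʳ (false ∷ x) (b ∷ y) (true ∷ z)  c = c , refl
redirect-∷ʳ (true ∷ x)  (b ∷ y) (false ∷ z) c = c , refl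

node-≡ : {a b : Node h} → path a ≡ path b → a ≡ b
node-≡ {a = node p _} {node .p _} refl = refl

module FromPaths {h : ℕ} (f g : List Bool → List Bool)
  (length-f : ∀ z → length (f z) ≡ length z) (length-g : ∀ z → length (g z) ≡ length z)
  (g∘f : ∀ z → g (f z) ≡ z) (f∘g : ∀ z → f (g z) ≡ z)
  (f-∷ʳ : ∀ z c → ∃ λ c′ → f (z ∷ʳ c) ≡ f z ∷ʳ c′)
  (g-∷ʳ : ∀ z c → ∃ λ c′ → g (z ∷ʳ c) ≡ g z ∷ʳ c′) where

  onNodes : (k : List Bool → List Bool) → (∀ z → length (k z) ≡ length z) → Node h → Node h
  onNodes k length-k (node p p<h) = node (k p) (subst (_< h) (sym (length-k p)) p<h)

  F G : Node h → Node h
  F = onNodes f length-f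
  G = onNodes g length-g

  F-edge : ∀ a b → E a b → E (F a) (F b)
  F-edge a b (c , b≡ac) = map₂ (trans (cong f b≡ac)) (f-∷ʳ (path a) c)

  F-edge⁻¹ : ∀ a b → E (F a) (F b) → E a b
  F-edge⁻¹ a b (c , fb≡fac) with g-∷ʳ (f (path a)) c
  ... | c′ , g≡ = c′ , (begin
      path b                  ≡⟨ g∘f (path b) ⟨
      g (f (path b))          ≡⟨ cong g fb≡fac ⟩
      g (f (path a) ∷ʳ c)     ≡⟨ g≡ ⟩
      g (f (path a)) ∷ʳ c′    ≡⟨ cong (_∷ʳ c′) (g∘f (path a)) ⟩
      path a ∷ʳ c′            ∎)

  aut : Aut h
  aut = record
    { fun   = F
    ; inv   = G
    ; left  = λ a → node-≡ (g∘f (path a))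
    ; right = λ a → node-≡ (f∘g (path a))
    ; pres  = λ a b → F-edge a b , F-edge⁻¹ a b
    }

redirectAut : List Bool → List Bool → Aut h
redirectAut x y = FromPaths.aut (redirect x y) (redirect y x)
  (length-redirect x y) (length-redirect y x) (redirect-inverse x y) (redirect-inverse y x)
  (redirect-∷ʳ x y) (redirect-∷ʳ y x)

idAut : Aut h
idAut = record
  { fun = id ; inv = id ; left = λ _ → refl ; right = λ _ → refl
  ; pres = λ _ _ → id , id }

_∘Aut_ : Aut h → Aut h → Aut h
β ∘Aut α = record
  { fun   = fun β ∘ fun α
  ; inv   = inv α ∘ inv β
  ; left  = λ a → trans (cong (inv α) (left β (fun α a))) (left α a)
  ; right = λ a → trans (cong (fun β) (right α (inv β a))) (right β a)
  ; pres  = λ a b → proj₁ (pres β _ _) ∘ proj₁ (pres α a b)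
                  , proj₂ (pres α a b) ∘ proj₂ (pres β _ _)
  }

-- True of every automorphism, but only needed (and proved) for those built here.
PreservesLca : Aut h → Set
PreservesLca α = ∀ u w → lcaDepth (fun α u) (fun α w) ≡ lcaDepth u w

redirectAut-preservesLca : ∀ x y → PreservesLca {h} (redirectAut x y)
redirectAut-preservesLca x y u w = lcp-redirect x y (path u) (path w)

++-injective : (xs xs′ ys ys′ : List A) → length xs ≡ length xs′ →
  xs L.++ ys ≡ xs′ L.++ ys′ → xs ≡ xs′ × ys ≡ ys′
++-injective []       []         ys ys′ _  eq = refl , eq
++-injective (x ∷ xs) (x′ ∷ xs′) ys ys′ ∣xs∣≡ eq =
  let x≡x′ , eq′ = Listₚ.∷-injective eq
      xs≡xs′ , ys≡ys′ = ++-injective xs xs′ ys ys′ (suc-injective ∣xs∣≡) eq′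
  in cong₂ _∷_ x≡x′ xs≡xs′ , ys≡ys′

length-map-toList : (f : A → B) (v : Vec A n) → length (L.map f (toList v)) ≡ n
length-map-toList f v = trans (Listₚ.length-map f (toList v)) (Vecₚ.length-toList v)

charTuple-∷-injective : (b c : Node h) (bs cs : Vec (Node h) n) →
  charTuple (b V.∷ bs) ≡ charTuple (c V.∷ cs) →
  depth b ≡ depth c × L.map (lcaDepth b) (toList bs) ≡ L.map (lcaDepth c) (toList cs) ×
  charTuple bs ≡ charTuple cs
charTuple-∷-injective b c bs cs eq =
  let depth≡ , eq′ = Listₚ.∷-injective eq
  in depth≡ , ++-injective _ _ _ _
       (trans (length-map-toList (lcaDepth b) bs) (sym (length-map-toList (lcaDepth c) cs))) eq′

redirectAut-fixes-map : (α : Aut h) → PreservesLca α → (b c : Node h) (bs : Vec (Node h) n) →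
  L.map (lcaDepth b) (toList bs) ≡ L.map (lcaDepth c) (toList (V.map (fun α) bs)) →
  V.map (fun (redirectAut (path (fun α b)) (path c))) (V.map (fun α) bs) ≡ V.map (fun α) bs
redirectAut-fixes-map α α-lca b c V.[] _ = refl
redirectAut-fixes-map α α-lca b c (b′ V.∷ bs) eq =
  let lca≡ , eq′ = Listₚ.∷-injective eq
  in cong₂ V._∷_
       (node-≡ (redirect-fixes _ _ _ (trans (α-lca b b′) lca≡)))
       (redirectAut-fixes-map α α-lca b c bs eq′)

charTuple-≡⇒aut : (b c : Vec (Node h) n) → charTuple b ≡ charTuple c →
  Σ (Aut h) λ α → PreservesLca α × V.map (fun α) b ≡ c
charTuple-≡⇒aut V.[] V.[] _ = idAut , (λ _ _ → refl) , refl
charTuple-≡⇒aut {h} (b V.∷ bs) (c V.∷ cs) eq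
  with depth≡ , lca≡ , rest≡ ← charTuple-∷-injective b c bs cs eq
  with charTuple-≡⇒aut bs cs rest≡
... | α , α-lca , refl = β ∘Aut α , βα-lca , cong₂ V._∷_ b↦c bs-fixed
  where
  β : Aut h
  β = redirectAut (path (fun α b)) (path c)
  βα-lca : PreservesLca (β ∘Aut α)
  βα-lca u w = trans (redirectAut-preservesLca (path (fun α b)) (path c) (fun α u) (fun α w)) (α-lca u w)
  b↦c : fun β (fun α b) ≡ c
  b↦c = node-≡ (redirect-source (path (fun α b)) (path c)
    (trans (sym (lcp-self (path (fun α b)))) (trans (α-lca b b) (trans (lcp-self (path b)) depth≡))))
  bs-fixed : V.map (fun β ∘ fun α) bs ≡ V.map (fun α) bs
  bs-fixed = trans (Vecₚ.map-∘ (fun β) (fun α) bs) (redirectAut-fixes-map α α-lca b c bs lca≡)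

lcaDepthOf : (A → Node h) → A × A → ℕ
lcaDepthOf F (i , j) = lcaDepth (F i) (F j)

charTuple-map : (F : A → Node h) (v : Vec A n) →
  charTuple (V.map F v) ≡ L.map (lcaDepthOf F) (charVars (toList v))
charTuple-map F V.[] = refl
charTuple-map F (x V.∷ v) = cong₂ _∷_ (sym (lcp-self (path (F x)))) (begin
    L.map (lcaDepth (F x)) (toList (V.map F v)) L.++ charTuple (V.map F v)
  ≡⟨ cong₂ L._++_ row (charTuple-map F v) ⟩
    L.map (lcaDepthOf F) (L.map (x ,_) (toList v)) L.++ L.map (lcaDepthOf F) (charVars (toList v))
  ≡⟨ Listₚ.map-++ (lcaDepthOf F) (L.map (x ,_) (toList v)) (charVars (toList v)) ⟨
    L.map (lcaDepthOf F) (L.map (x ,_) (toList v) L.++ charVars (toList v))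
  ∎)
  where
  row : L.map (lcaDepth (F x)) (toList (V.map F v)) ≡ L.map (lcaDepthOf F) (L.map (x ,_) (toList v))
  row = trans (cong (L.map (lcaDepth (F x))) (Vecₚ.toList-map F v))
          (trans (sym (Listₚ.map-∘ (toList v))) (Listₚ.map-∘ (toList v)))

allFin-+ : ∀ t s → allFin (t + s) ≡ V.map (_↑ˡ s) (allFin t) V.++ V.map (t ↑ʳ_) (allFin s)
allFin-+ zero    s = sym (Vecₚ.map-id (allFin s))
allFin-+ (suc t) s = begin
    allFin (suc t + s)
  ≡⟨ Vecₚ.allFin-map (t + s) ⟩
    Fin.zero V.∷ V.map Fin.suc (allFin (t + s))
  ≡⟨ cong (λ v → Fin.zero V.∷ V.map Fin.suc v) (allFin-+ t s) ⟩
    Fin.zero V.∷ V.map Fin.suc (V.map (_↑ˡ s) (allFin t) V.++ V.map (t ↑ʳ_) (allFin s))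
  ≡⟨ cong (Fin.zero V.∷_) (Vecₚ.map-++ Fin.suc (V.map (_↑ˡ s) (allFin t)) (V.map (t ↑ʳ_) (allFin s))) ⟩
    Fin.zero V.∷ (V.map Fin.suc (V.map (_↑ˡ s) (allFin t)) V.++ V.map Fin.suc (V.map (t ↑ʳ_) (allFin s)))
  ≡⟨ cong₂ (λ u w → Fin.zero V.∷ (u V.++ w))
       (trans (sym (Vecₚ.map-∘ Fin.suc (_↑ˡ s) (allFin t))) (Vecₚ.map-∘ (_↑ˡ s) Fin.suc (allFin t)))
       (sym (Vecₚ.map-∘ Fin.suc (t ↑ʳ_) (allFin s))) ⟩
    V.map (_↑ˡ s) (Fin.zero V.∷ V.map Fin.suc (allFin t)) V.++ V.map (suc t ↑ʳ_) (allFin s)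
  ≡⟨ cong (λ v → V.map (_↑ˡ s) v V.++ V.map (suc t ↑ʳ_) (allFin s)) (Vecₚ.allFin-map t) ⟨
    V.map (_↑ˡ s) (allFin (suc t)) V.++ V.map (suc t ↑ʳ_) (allFin s)
  ∎

charVars-++⁺ʳ : ∀ (xs : List A) {ys p} → p ∈ charVars ys → p ∈ charVars (xs L.++ ys)
charVars-++⁺ʳ []       p∈ = p∈
charVars-++⁺ʳ (x ∷ xs) p∈ = there (∈-++⁺ʳ _ (charVars-++⁺ʳ xs p∈))

varsZ⊆varsYZ : ∀ s t {p} → p ∈ varsZ s t → p ∈ varsYZ s t
varsZ⊆varsYZ s t p∈ = subst (λ v → _ ∈ charVars (toList v)) (sym (allFin-+ t s))
  (subst (λ l → _ ∈ charVars l) (sym (Vecₚ.toList-++ (V.map (_↑ˡ s) (allFin t)) (V.map (t ↑ʳ_) (allFin s))))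
    (charVars-++⁺ʳ (toList (V.map (_↑ˡ s) (allFin t))) p∈))

charTuple-++ : (y : Vec (Node h) t) (z : Vec (Node h) s) →
  charTuple (y V.++ z) ≡ L.map (lcaDepthOf (lookup (y V.++ z))) (varsYZ s t)
charTuple-++ y z = trans (cong charTuple (sym (Vecₚ.map-lookup-allFin (y V.++ z))))
  (charTuple-map (lookup (y V.++ z)) (allFin _))

charTuple-++ʳ : (y : Vec (Node h) t) (z : Vec (Node h) s) →
  charTuple z ≡ L.map (lcaDepthOf (lookup (y V.++ z))) (varsZ s t)
charTuple-++ʳ {t = t} {s = s} y z = trans (cong charTuple (sym lookup-z))
  (charTuple-map (lookup (y V.++ z)) (V.map (t ↑ʳ_) (allFin s)))
  where
  lookup-z : V.map (lookup (y V.++ z)) (V.map (t ↑ʳ_) (allFin s)) ≡ z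
  lookup-z = trans (sym (Vecₚ.map-∘ (lookup (y V.++ z)) (t ↑ʳ_) (allFin s)))
    (trans (Vecₚ.map-cong (Vecₚ.lookup-++ʳ y z) (allFin s)) (Vecₚ.map-lookup-allFin z))

zip-map-self : (f : A → B) (xs : List A) → zip xs (L.map f xs) ≡ L.map (λ v → v , f v) xs
zip-map-self f []       = refl
zip-map-self f (x ∷ xs) = cong (_ ∷_) (zip-map-self f xs)

∈-zip-map⁻ : (f : A → B) (xs : List A) {v : A} {x : B} → (v , x) ∈ zip xs (L.map f xs) → x ≡ f v
∈-zip-map⁻ f xs p∈ with ∈-map⁻ (λ v → v , f v) (subst (_ ∈_) (zip-map-self f xs) p∈)
... | _ , _ , refl = refl

∈-zip-map⁺ : (f : A → B) (xs : List A) {v : A} → v ∈ xs → (v , f v) ∈ zip xs (L.map f xs)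
∈-zip-map⁺ f xs v∈ = subst (_ ∈_) (sym (zip-map-self f xs)) (∈-map⁺ (λ v → v , f v) v∈)

Agree-map : ∀ s t (f : Fin (t + s) × Fin (t + s) → ℕ) →
  Agree s t (L.map f (varsYZ s t)) (L.map f (varsZ s t))
Agree-map s t f p∈ q∈ = trans (∈-zip-map⁻ f (varsYZ s t) p∈) (sym (∈-zip-map⁻ f (varsZ s t) q∈))

Agree⇒map-≡ : ∀ s t (f g : Fin (t + s) × Fin (t + s) → ℕ) →
  Agree s t (L.map f (varsYZ s t)) (L.map g (varsZ s t)) →
  L.map f (varsZ s t) ≡ L.map g (varsZ s t)
Agree⇒map-≡ s t f g agree = Listₚ.map-cong-local (All.tabulate λ p∈ →
  agree (∈-zip-map⁺ f (varsYZ s t) (varsZ⊆varsYZ s t p∈)) (∈-zip-map⁺ g (varsZ s t) p∈))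

Agree-charTuple : (y : Vec (Node h) t) (z : Vec (Node h) s) →
  Agree s t (charTuple (y V.++ z)) (charTuple z)
Agree-charTuple {t = t} {s = s} y z = subst₂ (Agree s t) (sym (charTuple-++ y z)) (sym (charTuple-++ʳ y z))
  (Agree-map s t (lcaDepthOf (lookup (y V.++ z))))

Agree-charTuple⁻ : (y : Vec (Node h) t) (z a : Vec (Node h) s) →
  Agree s t (charTuple (y V.++ z)) (charTuple a) → charTuple z ≡ charTuple a
Agree-charTuple⁻ {t = t} {s = s} y z a agree = begin
    charTuple z                                          ≡⟨ charTuple-++ʳ y z ⟩
    L.map (lcaDepthOf (lookup (y V.++ z))) (varsZ s t)  ≡⟨ Agree⇒map-≡ s t _ _ agree′ ⟩
    L.map (lcaDepthOf (lookup (y V.++ a))) (varsZ s t)  ≡⟨ charTuple-++ʳ y a ⟨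
    charTuple a                                          ∎
  where
  agree′ : Agree s t (L.map (lcaDepthOf (lookup (y V.++ z))) (varsYZ s t))
                     (L.map (lcaDepthOf (lookup (y V.++ a))) (varsZ s t))
  agree′ = subst₂ (Agree s t) (charTuple-++ y z) (charTuple-++ʳ y a) agree

tri-suc : ∀ n → tri (suc n) ≡ suc n + tri n
tri-suc n = begin
    (suc n * suc (suc n)) / 2        ≡⟨ cong (_/ 2) (expand n) ⟩
    (n * suc n + suc n * 2) / 2      ≡⟨ +-distrib-/-∣ʳ (n * suc n) (divides (suc n) refl) ⟩
    tri n + (suc n * 2) / 2          ≡⟨ cong (tri n +_) (m*n/n≡m (suc n) 2) ⟩
    tri n + suc n                    ≡⟨ +-comm (tri n) (suc n) ⟩
    suc n + tri n                    ∎
  where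
  expand : ∀ n → suc n * suc (suc n) ≡ n * suc n + suc n * 2
  expand = solve-∀

length-charTuple : (v : Vec (Node h) n) → length (charTuple v) ≡ tri n
length-charTuple V.[] = refl
length-charTuple {n = suc n} (a V.∷ v) = begin
    suc (length (L.map (lcaDepth a) (toList v) L.++ charTuple v))
  ≡⟨ cong suc (Listₚ.length-++ (L.map (lcaDepth a) (toList v))) ⟩
    suc (length (L.map (lcaDepth a) (toList v)) + length (charTuple v))
  ≡⟨ cong suc (cong₂ _+_ (length-map-toList (lcaDepth a) v) (length-charTuple v)) ⟩
    suc n + tri n
  ≡⟨ tri-suc n ⟨
    tri (suc n)
  ∎

depth< : (a : Node h) → depth a < h
depth< {h} (node p p<h) = recompute (length p <? h) p<h

lcaDepth< : (a b : Node h) → lcaDepth a b < h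
lcaDepth< a b = ≤-trans (s≤s (lcp-≤ (path a) (path b))) (depth< a)

charTuple-inRange : (v : Vec (Node h) n) → InRange h (tri n) (charTuple v)
charTuple-inRange v = length-charTuple v , entries< v
  where
  entries< : ∀ {h n} (v : Vec (Node h) n) → All (_< h) (charTuple v)
  entries< V.[] = []
  entries< (a V.∷ v) = depth< a ∷ Allₚ.++⁺ (Allₚ.map⁺ (All.tabulate λ {b} _ → lcaDepth< a b)) (entries< v)

module _ {R : Vec (Node h) n → Set} (invariant : Invariant R) where

  invariant-map : (α : Aut h) {b : Vec (Node h) n} → R b → R (V.map (fun α) b)
  invariant-map α {b} Rb = proj₁ (invariant α) (V.map (fun α) b) (b , Rb , refl)

  CharRel⇒R : {b : Vec (Node h) n} → CharRel R (charTuple b) → R b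
  CharRel⇒R {b} (c , Rc , c≡b) =
    let α , _ , αc≡b = charTuple-≡⇒aut c b c≡b
    in subst R αc≡b (invariant-map α Rc)

module _ {R : Vec (Node h) (t + s) → Set} (invariant : Invariant R) where

  Q₁-respects-charTuple : {a z : Vec (Node h) s} → charTuple a ≡ charTuple z → Q₁ s t R a → Q₁ s t R z
  Q₁-respects-charTuple {a} {z} a≡z a∈Q₁ y =
    let α , _ , αa≡z = charTuple-≡⇒aut a z a≡z
        α⁻¹y = V.map (inv α) y
        αα⁻¹y≡y = trans (sym (Vecₚ.map-∘ (fun α) (inv α) y))
                        (trans (Vecₚ.map-cong (right α) y) (Vecₚ.map-id y))
    in subst R (trans (Vecₚ.map-++ (fun α) α⁻¹y a) (cong₂ V._++_ αα⁻¹y≡y αa≡z))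
         (invariant-map invariant α (a∈Q₁ α⁻¹y))

  Q₁-agreeing : {a : Vec (Node h) s} → Q₁ s t R a →
    (b : Vec (Node h) (t + s)) → Agree s t (charTuple b) (charTuple a) → R b
  Q₁-agreeing {a} a∈Q₁ b agree with V.splitAt t b
  ... | y , z , refl = Q₁-respects-charTuple (sym (Agree-charTuple⁻ y z a agree)) a∈Q₁ y

  Q₁*⇒Q₂ : {e : List ℕ} → Q₁* s t R e → Q₂ h s t R e
  Q₁*⇒Q₂ (a , a∈Q₁ , refl) = charTuple-inRange a , (a , refl) ,
    λ { g _ agree (b , refl) → b , Q₁-agreeing a∈Q₁ b agree , refl }

  Q₂⇒Q₁* : {e : List ℕ} → Q₂ h s t R e → Q₁* s t R e
  Q₂⇒Q₁* (_ , (a , refl) , charRel) = a , a∈Q₁ , refl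
    where
    a∈Q₁ : Q₁ s t R a
    a∈Q₁ y = CharRel⇒R invariant
      (charRel _ (charTuple-inRange (y V.++ a)) (Agree-charTuple y a) (y V.++ a , refl))

lemma4 : (m h : ℕ) → 1 ≤ h → (s t : ℕ) → 1 ≤ s → 1 ≤ t → s + t ≤ m →
    (R : Vec (Node h) (t + s) → Set) → Invariant R →
    (e : List ℕ) → (Q₁* s t R e → Q₂ h s t R e) × (Q₂ h s t R e → Q₁* s t R e)
lemma4 _ _ _ _ _ _ _ _ _ invariant _ = Q₁*⇒Q₂ invariant , Q₂⇒Q₁* invariant
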